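{- For every integer $t\geq 6$, $\mathrm{oh}(K_t\times K_3)=t+2$.
   Context: $\mathrm{oh}(G)$ (Odd Hadwiger number) of a finite simple graph $G$ is the largest integer $m$ for which there exist $m$ pairwise vertex-disjoint trees $Z_1,\dots,Z_m$ in $G$ and a 2-colouring $c$ of $V(Z_1)\cup\dots\cup V(Z_m)$ that is proper on each $Z_k$, such that for every $k\neq k'$ there is an edge $xy\in E(G)$ with $x\in V(Z_k)$, $y\in V(Z_{k'})$, $c(x)=c(y)$. The direct product $G\times H$ has vertex set $V(G)\times V(H)$, with $(v_1,u_1)\sim(v_2,u_2)$ iff $v_1v_2\in E(G)$ and $u_1u_2\in E(H)$. -}

module Defs where

open import Data.Nat using (ℕ; _≤_)
open import Data.Fin using (Fin)
open import Data.Bool using (Bool)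
open import Data.List using (List; []; _∷_; length)
open import Data.List.Relation.Unary.Unique.Propositional using (Unique)
open import Data.Product using (Σ; ∃; ∃-syntax; _×_; _,_)
open import Data.Unit using (⊤)
open import Data.Empty using (⊥)
open import Relation.Nullary using (¬_)
open import Relation.Binary.PropositionalEquality using (_≡_; _≢_)

record Graph : Set₁ where
  field
    V   : Set
    Adj : V → V → Set

K : ℕ → Graph
K t = record { V = Fin t ; Adj = λ i j → i ≢ j }

_⊗_ : Graph → Graph → Graph
G ⊗ H = record
  { V   = Graph.V G × Graph.V H
  ; Adj = λ { (v₁ , u₁) (v₂ , u₂) → Graph.Adj G v₁ v₂ × Graph.Adj H u₁ u₂ } }

module _ (G : Graph) where
  open Graph G

  lastFrom : V → List V → V
  lastFrom x []       = x
  lastFrom x (y ∷ ys) = lastFrom y ys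

  Chain : (V → V → Set) → V → List V → Set
  Chain E x []       = ⊤
  Chain E x (y ∷ ys) = E x y × Chain E y ys

  record Subgraph : Set₁ where
    field
      VS     : V → Set
      ES     : V → V → Set
      ES⊆E   : ∀ {x y} → ES x y → Adj x y
      ES-sym : ∀ {x y} → ES x y → ES y x
      ES-VSˡ : ∀ {x y} → ES x y → VS x
      ES-VSʳ : ∀ {x y} → ES x y → VS y

  IsCycle : (V → V → Set) → V → List V → Set
  IsCycle E x xs = (2 ≤ length xs) × Unique (x ∷ xs) × Chain E x xs × E (lastFrom x xs) x

  record IsTree (Z : Subgraph) : Set where
    open Subgraph Z
    field
      nonempty  : ∃[ x ] VS x
      connected : ∀ x y → VS x → VS y → ∃[ xs ] (Chain ES x xs × lastFrom x xs ≡ y)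
      acyclic   : ∀ x xs → ¬ IsCycle ES x xs

  record Tree : Set₁ where
    field
      sub    : Subgraph
      isTree : IsTree sub
    open Subgraph sub public

  -- An odd clique minor model with m branch trees.  The 2-colouring c is given on all
  -- of V; only its values on the union of the trees matter.
  record OddModel (m : ℕ) : Set₁ where
    field
      Z        : Fin m → Tree
      c        : V → Bool
      disjoint : ∀ k k' x → k ≢ k' → Tree.VS (Z k) x → Tree.VS (Z k') x → ⊥
      proper   : ∀ k x y → Tree.ES (Z k) x y → c x ≢ c y
      odd-edge : ∀ k k' → k ≢ k' →
                 ∃[ x ] ∃[ y ] (Adj x y × Tree.VS (Z k) x × Tree.VS (Z k') y × c x ≡ c y)

  IsOddHadwigerNumber : ℕ → Set₁
  IsOddHadwigerNumber m = OddModel m × (∀ m' → OddModel m' → m' ≤ m)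

module Submission where

-- Upper bound: charge every branch tree three distinct tokens, drawn from the 3t vertices
-- and the 6 ordered pairs of distinct columns, so that no token is charged twice; then
-- 3m ≤ 3t + 6.  A tree with three vertices takes three of them.  Single-vertex trees all
-- have one colour α, since any two are joined by a monochromatic edge.  A two-vertex tree
-- is an edge xy between different columns with c x = α ≠ c y; it takes x, y and the pair
-- (col x , col y).  A single vertex u takes u and both pairs (col u , b).  Two trees taking
-- the same pair would need a monochromatic edge between them, but every candidate edge
-- joins equal columns or different colours.
--
-- Lower bound (already for t ≥ 5): rows 0-2 carry a single vertex and four edges, and every
-- further row j carries the two leaves of a star whose centre sits in column 1 of row j - 1
-- (cyclically among these rows); one colouring then provides all the odd edges.

open import Defs
open import Data.Nat using (ℕ; suc; s≤s; _≤_; _+_; _*_; _≤?_)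
open import Data.Nat.Properties using (*-cancelʳ-≤; *-distribʳ-+; 1+n≢n; +-comm; <⇒≤; m≤n⇒∃[o]m+o≡n)
open import Data.Bool using (Bool; true; false)
open import Data.Bool.Properties using (not-injective; ¬-not) renaming (_≟_ to _≟ᵇ_)
open import Data.Empty using (⊥; ⊥-elim)
open import Data.Fin using (Fin; suc; punchIn; punchOut; fromℕ; inject₁; toℕ; _↑ʳ_; splitAt)
open import Data.Fin.Relation.Unary.Top using (View; view; ‵fromℕ; ‵inject₁; view-fromℕ; view-inject₁)
open import Data.Fin.Patterns using (0F; 1F; 2F; 3F; 4F)
open import Data.Fin.Properties as Fin using (punchIn-punchOut; *↔×; +↔⊎; injective⇒≤; toℕ-inject₁; ↑ʳ-injective)
open import Data.List using (List; []; _∷_)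
open import Data.List.Membership.Propositional using (_∈_; find)
open import Data.List.Relation.Unary.All as All using (All; []; _∷_)
open import Data.List.Relation.Unary.Any as Any using (Any; here; there)
open import Data.List.Relation.Unary.AllPairs using (_∷_)
open import Data.Product using (∃; ∃-syntax; _×_; _,_; proj₁; proj₂)
open import Data.Product.Properties using () renaming (≡-dec to ×-≡-dec)
open import Data.Sum using (_⊎_; inj₁; inj₂; [_,_]; swap)
open import Data.Sum.Properties using (inj₁-injective; ≡-dec)
open import Data.Sum.Function.Propositional using (_⊎-↔_)
open import Data.Unit using (tt)
open import Effect.Monad using (RawMonad)
open import Level using (0ℓ)
open import Function using (_∘_; _$_)
open import Function.Bundles using (_↣_; _↔_; mk↣; Injection)
open import Function.Construct.Composition using (_↣-∘_; _↔-∘_)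
open import Function.Definitions using (Injective)
open import Function.Properties.Inverse using (↔-sym; ↔⇒↣)
open import Relation.Binary.Definitions using (DecidableEquality; Symmetric)
open import Relation.Binary.PropositionalEquality using (_≡_; _≢_; refl; sym; trans; cong; subst)
open import Relation.Nullary using (¬_; Dec; yes; no; ¬?)
open import Relation.Nullary.Decidable using (decidable-stable; ¬¬-excluded-middle; from-yes; _×-dec_; _→-dec_)
open import Relation.Nullary.Negation using (¬¬-Monad)

open RawMonad (¬¬-Monad {0ℓ}) using (pure; _>>=_; rawApplicative)

≢-≢⇒≡ : ∀ {a b c : Bool} → a ≢ b → a ≢ c → b ≡ c
≢-≢⇒≡ a≢b a≢c = not-injective (trans (sym (¬-not a≢b)) (¬-not a≢c))

injection⇒≤ : ∀ {m t} → (Fin m × Fin 3) ↣ ((Fin t × Fin 3) ⊎ (Fin 3 × Fin 2)) → m ≤ t + 2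
injection⇒≤ {m} {t} f =
  *-cancelʳ-≤ m (t + 2) 3 (subst (m * 3 ≤_) (sym (*-distribʳ-+ 3 t 2)) m*3≤)
  where
  codomain↔ : ((Fin t × Fin 3) ⊎ (Fin 3 × Fin 2)) ↔ Fin (t * 3 + 3 * 2)
  codomain↔ = ↔-sym ((*↔× ⊎-↔ *↔×) ↔-∘ +↔⊎)

  m*3≤ : m * 3 ≤ t * 3 + 3 * 2
  m*3≤ = injective⇒≤ (Injection.injective (↔⇒↣ codomain↔ ↣-∘ (f ↣-∘ ↔⇒↣ *↔×)))

data Size {A : Set} (P : A → Set) : Set where
  atLeast3 : ∀ {x y z} → P x → P y → P z → x ≢ y → x ≢ z → y ≢ z → Size P
  exactly2 : ∀ {x y} → P x → P y → x ≢ y → (∀ {w} → P w → w ≡ x ⊎ w ≡ y) → Size P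
  exactly1 : ∀ {x} → P x → (∀ {w} → P w → w ≡ x) → Size P

¬¬-size : {A : Set} {P : A → Set} → DecidableEquality A → ∃ P → ¬ ¬ Size P
¬¬-size {P = P} _≟_ (x , px) = do
  yes (y , py , y≢x) ← ¬¬-excluded-middle {A = ∃ λ y → P y × y ≢ x}
    where no ∄y → pure (exactly1 px (only-x ∄y))
  yes (z , pz , z≢x , z≢y) ← ¬¬-excluded-middle {A = ∃ λ z → P z × z ≢ x × z ≢ y}
    where no ∄z → pure (exactly2 px py (y≢x ∘ sym) (only-x-y ∄z))
  pure (atLeast3 px py pz (y≢x ∘ sym) (z≢x ∘ sym) (z≢y ∘ sym))
  where
  only-x : ¬ (∃ λ y → P y × y ≢ x) → ∀ {w} → P w → w ≡ x
  only-x ∄y {w} pw = decidable-stable (w ≟ x) (λ w≢x → ∄y (w , pw , w≢x))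

  only-x-y : ∀ {y} → ¬ (∃ λ z → P z × z ≢ x × z ≢ y) → ∀ {w} → P w → w ≡ x ⊎ w ≡ y
  only-x-y {y} ∄z {w} pw with w ≟ x | w ≟ y
  ... | yes w≡x | _       = inj₁ w≡x
  ... | no _    | yes w≡y = inj₂ w≡y
  ... | no w≢x  | no w≢y  = ⊥-elim (∄z (w , pw , w≢x , w≢y))

module _ {G : Graph} (irreflexive : ∀ {x} → ¬ Graph.Adj G x x) (T : Tree G) where
  open Tree T

  two-vertex-tree-edge : ∀ {x y} → VS x → VS y → x ≢ y → (∀ {w} → VS w → w ≡ x ⊎ w ≡ y) → ES x y
  two-vertex-tree-edge {x} {y} x∈ y∈ x≢y within with IsTree.connected isTree x y x∈ y∈
  ... | [] , _ , x≡y = ⊥-elim (x≢y x≡y)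
  ... | w ∷ _ , (x~w , _) , _ with within (ES-VSʳ x~w)
  ...   | inj₁ refl = ⊥-elim (irreflexive (ES⊆E x~w))
  ...   | inj₂ refl = x~w

module Star (G : Graph) (adj-sym : Symmetric (Graph.Adj G)) (z : Graph.V G)
            (leaves : List (Graph.V G)) (z~leaves : All (Graph.Adj G z) leaves) where
  open Graph G

  StarEdge : V → V → Set
  StarEdge x y = (x ≡ z × y ∈ leaves) ⊎ (x ∈ leaves × y ≡ z)

  hub : ∀ {x y} → StarEdge x y → x ≡ z ⊎ y ≡ z
  hub (inj₁ (x≡z , _)) = inj₁ x≡z
  hub (inj₂ (_ , y≡z)) = inj₂ y≡z

  middle-is-centre : ∀ {x y w} → x ≢ w → StarEdge x y → StarEdge y w → y ≡ z
  middle-is-centre x≢w x~y y~w with hub x~y | hub y~w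
  ... | inj₂ y≡z | _        = y≡z
  ... | _        | inj₁ y≡z = y≡z
  ... | inj₁ x≡z | inj₂ w≡z = ⊥-elim (x≢w (trans x≡z (sym w≡z)))

  successor-on-cycle : ∀ {x y} ys → Chain G StarEdge y ys → StarEdge (lastFrom G y ys) x →
                       ∃[ w ] (StarEdge y w × (w ∈ ys ⊎ w ≡ x))
  successor-on-cycle []      _         closing = _ , closing , inj₂ refl
  successor-on-cycle (w ∷ _) (y~w , _) _       = w , y~w , inj₁ (here refl)

  acyclic : ∀ x xs → ¬ IsCycle G StarEdge x xs
  acyclic x [] (() , _)
  acyclic x (_ ∷ []) (s≤s () , _)
  acyclic x (x₁ ∷ x₂ ∷ xs)
          (_ , ((x≢x₁ ∷ x≢x₂ ∷ _) ∷ (x₁≢x₂ ∷ x₁∉xs) ∷ _) , (x~x₁ , x₁~x₂ , chain) , closing)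
    with successor-on-cycle xs chain closing
  ... | w , x₂~w , w-after = x₁≢x₂ (trans x₁≡z (sym x₂≡z))
    where
    x₁≢w : x₁ ≢ w
    x₁≢w = [ All.lookup x₁∉xs , (λ { refl → x≢x₁ ∘ sym }) ] w-after
    x₁≡z : x₁ ≡ z
    x₁≡z = middle-is-centre x≢x₂ x~x₁ x₁~x₂
    x₂≡z : x₂ ≡ z
    x₂≡z = middle-is-centre x₁≢w x₁~x₂ x₂~w

  connected : ∀ x y → x ∈ z ∷ leaves → y ∈ z ∷ leaves →
              ∃[ xs ] (Chain G StarEdge x xs × lastFrom G x xs ≡ y)
  connected x y (here refl) (here refl) = [] , tt , refl
  connected x y (here refl) (there y∈) = y ∷ [] , (inj₁ (refl , y∈) , tt) , refl
  connected x y (there x∈)  (here refl) = y ∷ [] , (inj₂ (x∈ , refl) , tt) , refl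
  connected x y (there x∈)  (there y∈) =
    z ∷ y ∷ [] , (inj₂ (x∈ , refl) , inj₁ (refl , y∈) , tt) , refl

  star : Tree G
  star = record
    { sub = record
      { VS     = _∈ z ∷ leaves
      ; ES     = StarEdge
      ; ES⊆E   = λ { (inj₁ (refl , y∈)) → All.lookup z~leaves y∈
                   ; (inj₂ (x∈ , refl)) → adj-sym (All.lookup z~leaves x∈) }
      ; ES-sym = λ { (inj₁ (x≡z , y∈)) → inj₂ (y∈ , x≡z) ; (inj₂ (x∈ , y≡z)) → inj₁ (y≡z , x∈) }
      ; ES-VSˡ = λ { (inj₁ (refl , _)) → here refl ; (inj₂ (x∈ , _)) → there x∈ }
      ; ES-VSʳ = λ { (inj₁ (_ , y∈)) → there y∈ ; (inj₂ (_ , refl)) → here refl } }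
    ; isTree = record
      { nonempty  = z , here refl
      ; connected = connected
      ; acyclic   = acyclic } }

  star-proper : {C : Set} (c : V → C) → All (λ y → c z ≢ c y) leaves →
                ∀ x y → StarEdge x y → c x ≢ c y
  star-proper c differ x y (inj₁ (refl , y∈)) = All.lookup differ y∈
  star-proper c differ x y (inj₂ (x∈ , refl)) = All.lookup differ x∈ ∘ sym

module UpperBound {t m : ℕ} (M : OddModel (K t ⊗ K 3) m) where
  open OddModel M

  V : Set
  V = Fin t × Fin 3

  column : V → Fin 3
  column = proj₂

  VS : Fin m → V → Set
  VS k = Tree.VS (Z k)

  irreflexive : ∀ {x} → ¬ Graph.Adj (K t ⊗ K 3) x x
  irreflexive (rows≢ , _) = rows≢ refl

  IsSingleton : Fin m → V → Set
  IsSingleton k u = VS k u × (∀ {z} → VS k z → z ≡ u)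

  SingletonsColoured : Bool → Set
  SingletonsColoured α = ∀ {k u} → IsSingleton k u → c u ≡ α

  singletons-same-colour : ∀ {k k' u u'} → IsSingleton k u → IsSingleton k' u' → c u ≡ c u'
  singletons-same-colour {k} {k'} (_ , only-u) (u'∈ , only-u') with k Fin.≟ k'
  ... | yes refl = cong c (sym (only-u u'∈))
  ... | no k≢k' with odd-edge k k' k≢k'
  ...   | x , y , _ , x∈ , y∈ , cx≡cy with only-u x∈ | only-u' y∈
  ...     | refl | refl = cx≡cy

  singleton-colour : Dec (∃[ k ] ∃[ u ] IsSingleton k u) → ∃ SingletonsColoured
  singleton-colour (yes (_ , u , single)) = c u , λ single' → singletons-same-colour single' single
  singleton-colour (no none)              = true , λ single → ⊥-elim (none (_ , _ , single))

  -- (a , i) stands for the ordered pair of distinct columns (a , punchIn a i)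
  ColumnPair : Set
  ColumnPair = Fin 3 × Fin 2

  Token : Set
  Token = V ⊎ ColumnPair

  module _ (α : Bool) where

    Claims : Fin m → ColumnPair → Set
    Claims k (a , i) =
      ∀ {z} → VS k z → (column z ≡ a × c z ≡ α) ⊎ (column z ≡ punchIn a i × c z ≢ α)

    Owns : Fin m → Token → Set
    Owns k (inj₁ v) = VS k v
    Owns k (inj₂ p) = Claims k p

    claims-exclusive : ∀ {k k' p} → k ≢ k' → Claims k p → Claims k' p → ⊥
    claims-exclusive {k} {k'} k≢k' claims claims' with odd-edge k k' k≢k'
    ... | x , y , (_ , columns≢) , x∈ , y∈ , cx≡cy with claims x∈ | claims' y∈
    ...   | inj₁ (x-in-a , _)  | inj₁ (y-in-a , _)  = columns≢ (trans x-in-a (sym y-in-a))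
    ...   | inj₂ (x-in-b , _)  | inj₂ (y-in-b , _)  = columns≢ (trans x-in-b (sym y-in-b))
    ...   | inj₁ (_ , cx≡α)    | inj₂ (_ , cy≢α)    = cy≢α (trans (sym cx≡cy) cx≡α)
    ...   | inj₂ (_ , cx≢α)    | inj₁ (_ , cy≡α)    = cx≢α (trans cx≡cy cy≡α)

    owns-exclusive : ∀ {k k'} τ → k ≢ k' → Owns k τ → Owns k' τ → ⊥
    owns-exclusive {k} {k'} (inj₁ v) k≢k' = disjoint k k' v k≢k'
    owns-exclusive          (inj₂ p) k≢k' = claims-exclusive k≢k'

    record OwnedTokens (k : Fin m) : Set where
      field
        token     : Fin 3 → Token
        injective : Injective _≡_ _≡_ token
        owned     : ∀ j → Owns k (token j)

    distinct-owned-tokens : ∀ {k τ₀ τ₁ τ₂} → Owns k τ₀ → Owns k τ₁ → Owns k τ₂ →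
                            τ₀ ≢ τ₁ → τ₀ ≢ τ₂ → τ₁ ≢ τ₂ → OwnedTokens k
    distinct-owned-tokens {τ₀ = τ₀} {τ₁} {τ₂} o₀ o₁ o₂ τ₀≢τ₁ τ₀≢τ₂ τ₁≢τ₂ = record
      { token     = token
      ; injective = λ {i} {j} → injective i j
      ; owned     = λ { 0F → o₀ ; 1F → o₁ ; 2F → o₂ } }
      where
      token : Fin 3 → Token
      token 0F = τ₀
      token 1F = τ₁
      token 2F = τ₂
      injective : ∀ i j → token i ≡ token j → i ≡ j
      injective 0F 0F _ = refl
      injective 1F 1F _ = refl
      injective 2F 2F _ = refl
      injective 0F 1F e = ⊥-elim (τ₀≢τ₁ e)
      injective 0F 2F e = ⊥-elim (τ₀≢τ₂ e)
      injective 1F 2F e = ⊥-elim (τ₁≢τ₂ e)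
      injective 1F 0F e = ⊥-elim (τ₀≢τ₁ (sym e))
      injective 2F 0F e = ⊥-elim (τ₀≢τ₂ (sym e))
      injective 2F 1F e = ⊥-elim (τ₁≢τ₂ (sym e))

    pair-tokens : ∀ {k x y} → VS k x → VS k y → (∀ {w} → VS k w → w ≡ x ⊎ w ≡ y) →
                  (columns≢ : column x ≢ column y) → c x ≡ α → c y ≢ α → OwnedTokens k
    pair-tokens {k} {x} {y} x∈ y∈ within columns≢ cx≡α cy≢α =
      distinct-owned-tokens {τ₂ = inj₂ (column x , punchOut columns≢)} x∈ y∈ claims
        (x≢y ∘ inj₁-injective) (λ ()) (λ ())
      where
      x≢y : x ≢ y
      x≢y refl = columns≢ refl
      claims : Claims k (column x , punchOut columns≢)
      claims w∈ with within w∈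
      ... | inj₁ refl = inj₁ (refl , cx≡α)
      ... | inj₂ refl = inj₂ (sym (punchIn-punchOut columns≢) , cy≢α)

    singleton-tokens : ∀ {k u} → IsSingleton k u → c u ≡ α → OwnedTokens k
    singleton-tokens {k} {u} (u∈ , only-u) cu≡α =
      distinct-owned-tokens {τ₁ = inj₂ (column u , 0F)} {τ₂ = inj₂ (column u , 1F)}
        u∈ claims claims (λ ()) (λ ()) (λ ())
      where
      claims : ∀ {i} → Claims k (column u , i)
      claims w∈ with only-u w∈
      ... | refl = inj₁ (refl , cu≡α)

    owned-tokens : SingletonsColoured α → ∀ {k} → Size (VS k) → OwnedTokens k
    owned-tokens _ (atLeast3 x∈ y∈ z∈ x≢y x≢z y≢z) =
      distinct-owned-tokens x∈ y∈ z∈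
        (x≢y ∘ inj₁-injective) (x≢z ∘ inj₁-injective) (y≢z ∘ inj₁-injective)
    owned-tokens coloured (exactly1 u∈ only-u) =
      singleton-tokens (u∈ , only-u) (coloured (u∈ , only-u))
    owned-tokens _ {k} (exactly2 {x} {y} x∈ y∈ x≢y within) = orient (c x ≟ᵇ α)
      where
      x~y : Tree.ES (Z k) x y
      x~y = two-vertex-tree-edge irreflexive (Z k) x∈ y∈ x≢y within
      columns≢ : column x ≢ column y
      columns≢ = proj₂ (Tree.ES⊆E (Z k) x~y)
      cx≢cy : c x ≢ c y
      cx≢cy = proper k x y x~y
      orient : Dec (c x ≡ α) → OwnedTokens k
      orient (yes cx≡α) = pair-tokens x∈ y∈ within columns≢ cx≡α (cx≢cy ∘ trans cx≡α ∘ sym)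
      orient (no cx≢α)  = pair-tokens y∈ x∈ (swap ∘ within) (columns≢ ∘ sym) (≢-≢⇒≡ cx≢cy cx≢α) cx≢α

    owned-tokens⇒≤ : (∀ k → OwnedTokens k) → m ≤ t + 2
    owned-tokens⇒≤ tokens = injection⇒≤ (mk↣ f-injective)
      where
      open OwnedTokens
      f : Fin m × Fin 3 → Token
      f (k , j) = token (tokens k) j
      f-injective : Injective _≡_ _≡_ f
      f-injective {k , j} {k' , j'} eq with k Fin.≟ k'
      ... | yes refl = cong (k ,_) (injective (tokens k) eq)
      ... | no k≢k'  = ⊥-elim $ owns-exclusive (f (k , j)) k≢k' (owned (tokens k) j)
                         (subst (Owns k') (sym eq) (owned (tokens k') j'))

  -- The vertex sets of the trees are not decidable, but m ≤ t + 2 is, so the case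
  -- analyses may be carried out under double negation.
  upper-bound : m ≤ t + 2
  upper-bound = decidable-stable (m ≤? t + 2) do
    sizes ← Fin.sequence rawApplicative λ k → ¬¬-size _≟ᵥ_ (IsTree.nonempty (Tree.isTree (Z k)))
    singleton? ← ¬¬-excluded-middle
    let α , coloured = singleton-colour singleton?
    pure (owned-tokens⇒≤ α λ k → owned-tokens α coloured (sizes k))
    where
    _≟ᵥ_ : DecidableEquality V
    _≟ᵥ_ = ×-≡-dec Fin._≟_ Fin._≟_

prev : ∀ {n} → Fin (suc n) → Fin (suc n)
prev {n} 0F = fromℕ n
prev (suc i) = inject₁ i

next : ∀ {n} → Fin (suc n) → Fin (suc n)
next i = next-view (view i)
  where
  next-view : ∀ {n} {i : Fin (suc n)} → View i → Fin (suc n)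
  next-view ‵fromℕ       = 0F
  next-view (‵inject₁ j) = suc j

next-prev : ∀ {n} (i : Fin (suc n)) → next (prev i) ≡ i
next-prev {n} 0F   rewrite view-fromℕ n   = refl
next-prev (suc i) rewrite view-inject₁ i = refl

prev-≢ : ∀ {n} (i : Fin (2 + n)) → prev i ≢ i
prev-≢ 0F      ()
prev-≢ (suc i) eq = 1+n≢n (trans (sym (cong toℕ eq)) (toℕ-inject₁ i))

module LowerBound (g : ℕ) where

  t : ℕ
  t = 3 + (2 + g)

  G : Graph
  G = K t ⊗ K 3

  V : Set
  V = Fin t × Fin 3

  open Graph G using (Adj)

  adj-sym : Symmetric Adj
  adj-sym (rows≢ , columns≢) = rows≢ ∘ sym , columns≢ ∘ sym

  adj? : ∀ x y → Dec (Adj x y)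
  adj? (r , a) (r' , a') = ¬? (r Fin.≟ r') ×-dec ¬? (a Fin.≟ a')

  generic : Fin (2 + g) → Fin t
  generic j = 3 ↑ʳ j

  colour : V → Bool
  colour (0F , 2F) = false
  colour (1F , 2F) = false
  colour (2F , 0F) = false
  colour (2F , 1F) = false
  colour (suc (suc (suc _)) , 1F) = false
  colour _ = true

  Index : Set
  Index = Fin 5 ⊎ Fin (2 + g)

  centre : Index → V
  centre (inj₁ 0F) = 2F , 2F
  centre (inj₁ 1F) = 0F , 0F
  centre (inj₁ 2F) = 0F , 1F
  centre (inj₁ 3F) = 0F , 2F
  centre (inj₁ 4F) = 1F , 0F
  centre (inj₂ j)  = generic (prev j) , 1F

  leaves : Index → List V
  leaves (inj₁ 0F) = []
  leaves (inj₁ 1F) = (1F , 2F) ∷ []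
  leaves (inj₁ 2F) = (2F , 0F) ∷ []
  leaves (inj₁ 3F) = (1F , 1F) ∷ []
  leaves (inj₁ 4F) = (2F , 1F) ∷ []
  leaves (inj₂ j)  = (generic j , 0F) ∷ (generic j , 2F) ∷ []

  vertices : Index → List V
  vertices i = centre i ∷ leaves i

  _≟ᵢ_ : DecidableEquality Index
  _≟ᵢ_ = ≡-dec Fin._≟_ Fin._≟_

  owner : V → Index
  owner (0F , 0F) = inj₁ 1F
  owner (0F , 1F) = inj₁ 2F
  owner (0F , 2F) = inj₁ 3F
  owner (1F , 0F) = inj₁ 4F
  owner (1F , 1F) = inj₁ 3F
  owner (1F , 2F) = inj₁ 1F
  owner (2F , 0F) = inj₁ 2F
  owner (2F , 1F) = inj₁ 4F
  owner (2F , 2F) = inj₁ 0F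
  owner (suc (suc (suc r)) , 1F) = inj₂ (next r)
  owner (suc (suc (suc r)) , _)  = inj₂ r

  ProperSpoke : Index → V → Set
  ProperSpoke i y = Adj (centre i) y × colour (centre i) ≢ colour y

  properSpoke? : ∀ i y → Dec (ProperSpoke i y)
  properSpoke? i y = adj? (centre i) y ×-dec ¬? (colour (centre i) ≟ᵇ colour y)

  AnyOddEdge : List V → List V → Set
  AnyOddEdge xs ys = Any (λ x → Any (λ y → Adj x y × colour x ≡ colour y) ys) xs

  anyOddEdge? : ∀ xs ys → Dec (AnyOddEdge xs ys)
  anyOddEdge? xs ys = Any.any? (λ x → Any.any? (λ y → adj? x y ×-dec colour x ≟ᵇ colour y) ys) xs

  special-star-edges : ∀ a → All (ProperSpoke (inj₁ a)) (leaves (inj₁ a))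
  special-star-edges = from-yes (Fin.all? λ a → All.all? (properSpoke? (inj₁ a)) (leaves (inj₁ a)))

  special-owner : ∀ a → All (λ x → owner x ≡ inj₁ a) (vertices (inj₁ a))
  special-owner = from-yes (Fin.all? λ a → All.all? (λ x → owner x ≟ᵢ inj₁ a) (vertices (inj₁ a)))

  special-odd-edges : ∀ a b → a ≢ b → AnyOddEdge (vertices (inj₁ a)) (vertices (inj₁ b))
  special-odd-edges = from-yes (Fin.all? λ a → Fin.all? λ b →
    ¬? (a Fin.≟ b) →-dec anyOddEdge? (vertices (inj₁ a)) (vertices (inj₁ b)))

  -- The decisions still evaluate for a variable j: a generic row is suc (suc (suc _)), which
  -- already differs from every special row.
  special-generic-odd-edges : ∀ j a → AnyOddEdge (vertices (inj₁ a)) (vertices (inj₂ j))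
  special-generic-odd-edges j =
    from-yes (Fin.all? λ a → anyOddEdge? (vertices (inj₁ a)) (vertices (inj₂ j)))

  generic-special-odd-edges : ∀ j a → AnyOddEdge (vertices (inj₂ j)) (vertices (inj₁ a))
  generic-special-odd-edges j =
    from-yes (Fin.all? λ a → anyOddEdge? (vertices (inj₂ j)) (vertices (inj₁ a)))

  star-edges : ∀ i → All (ProperSpoke i) (leaves i)
  star-edges (inj₁ a) = special-star-edges a
  star-edges (inj₂ j) = ((rows≢ , λ ()) , λ ()) ∷ ((rows≢ , λ ()) , λ ()) ∷ []
    where
    rows≢ : generic (prev j) ≢ generic j
    rows≢ = prev-≢ j ∘ ↑ʳ-injective 3 (prev j) j

  owner-of-vertices : ∀ i → All (λ x → owner x ≡ i) (vertices i)
  owner-of-vertices (inj₁ a) = special-owner a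
  owner-of-vertices (inj₂ j) = cong inj₂ (next-prev j) ∷ refl ∷ refl ∷ []

  module StarAt (i : Index) = Star G adj-sym (centre i) (leaves i) (All.map proj₁ (star-edges i))

  trees-disjoint : ∀ {i i' x} → i ≢ i' → x ∈ vertices i → x ∈ vertices i' → ⊥
  trees-disjoint {i} {i'} i≢i' x∈ x∈' =
    i≢i' (trans (sym (All.lookup (owner-of-vertices i) x∈)) (All.lookup (owner-of-vertices i') x∈'))

  OddEdge : List V → List V → Set
  OddEdge xs ys = ∃[ x ] ∃[ y ] (Adj x y × x ∈ xs × y ∈ ys × colour x ≡ colour y)

  AnyOddEdge⇒OddEdge : ∀ {xs ys} → AnyOddEdge xs ys → OddEdge xs ys
  AnyOddEdge⇒OddEdge e with find e
  ... | x , x∈ , e' with find e'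
  ...   | y , y∈ , x~y , same-colour = x , y , x~y , x∈ , y∈ , same-colour

  odd-edge : ∀ i i' → i ≢ i' → OddEdge (vertices i) (vertices i')
  odd-edge (inj₁ a) (inj₁ b) i≢i' = AnyOddEdge⇒OddEdge (special-odd-edges a b (i≢i' ∘ cong inj₁))
  odd-edge (inj₁ a) (inj₂ j) _    = AnyOddEdge⇒OddEdge (special-generic-odd-edges j a)
  odd-edge (inj₂ j) (inj₁ a) _    = AnyOddEdge⇒OddEdge (generic-special-odd-edges j a)
  odd-edge (inj₂ j) (inj₂ j') i≢i' =
    (generic j , 0F) , (generic j' , 2F) , (i≢i' ∘ cong inj₂ ∘ ↑ʳ-injective 3 j j' , λ ()) ,
    there (here refl) , there (there (here refl)) , refl

  model : OddModel G (5 + (2 + g))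
  model = record
    { Z        = StarAt.star ∘ index
    ; c        = colour
    ; disjoint = λ k k' _ k≢k' → trees-disjoint (k≢k' ∘ index-injective)
    ; proper   = λ k → StarAt.star-proper (index k) colour (All.map proj₂ (star-edges (index k)))
    ; odd-edge = λ k k' k≢k' → odd-edge (index k) (index k') (k≢k' ∘ index-injective) }
    where
    index : Fin (5 + (2 + g)) → Index
    index = splitAt 5
    index-injective : Injective _≡_ _≡_ index
    index-injective = Injection.injective (↔⇒↣ +↔⊎)

lower-bound : ∀ {t} → 5 ≤ t → OddModel (K t ⊗ K 3) (t + 2)
lower-bound 5≤t with m≤n⇒∃[o]m+o≡n 5≤t
... | g , refl = subst (OddModel _) (cong (5 +_) (+-comm 2 g)) (LowerBound.model g)

lemma11 : ∀ (t : ℕ) → 6 ≤ t → IsOddHadwigerNumber (K t ⊗ K 3) (t + 2)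
lemma11 t 6≤t = lower-bound (<⇒≤ 6≤t) , λ _ model → UpperBound.upper-bound model
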